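{- Let $G$ be a directed graph with $n$ vertices and source $s$ from which every vertex is reachable, and let $T_D^G$ be its dominator tree. Assume that no node of $T_D^G$ has outdegree exactly $1$. Then $\log(\mathrm{Lin}(G))=\Omega(n)$.
   Context: Vertex $u$ dominates $v$ if every path from $s$ to $v$ visits $u$. The immediate dominator of $v\neq s$ is the unique dominator $u\neq v$ of $v$ that is dominated by all other dominators of $v$ distinct from $v$. The dominator tree $T_D^G$ is rooted at $s$ with the parent of each $v\ne s$ being its immediate dominator (not necessarily a subgraph of $G$). A spanning tree of $G$ is a spanning tree rooted at $s$ with edges of $G$ directed away from $s$; a linearization of a rooted tree is a linear order of its vertices in which no vertex precedes one of its ancestors; a linearization of $G$ is a linearization of some spanning tree of $G$, and $\mathrm{Lin}(G)$ is the number of linearizations of $G$. Logarithms base 2. -}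

module Defs where

open import Data.Nat using (ℕ; _^_; _*_; _≤_; _<_)
open import Data.Fin using (Fin)
open import Data.Bool using (Bool; T)
open import Data.List using (List; []; _∷_; _++_; length)
open import Data.List.Membership.Propositional using (_∈_)
open import Data.List.Relation.Unary.All using (All)
open import Data.List.Relation.Unary.Unique.Propositional using (Unique)
open import Data.Product using (Σ; ∃; _×_; _,_)
open import Data.Sum using (_⊎_)
open import Relation.Binary.PropositionalEquality using (_≡_; _≢_)
open import Relation.Nullary using (¬_)

Graph : ℕ → Set
Graph n = Fin n → Fin n → Bool

Edge : ∀ {n} → Graph n → Fin n → Fin n → Set
Edge G u v = T (G u v)

-- Walk G s v vs : vs is the (reversed) list of vertices of a walk in G from s to v.
data Walk {n} (G : Graph n) (s : Fin n) : Fin n → List (Fin n) → Set where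
  start : Walk G s s (s ∷ [])
  step  : ∀ {u v vs} → Walk G s u vs → Edge G u v → Walk G s v (v ∷ vs)

AllReachable : ∀ {n} → Graph n → Fin n → Set
AllReachable G s = ∀ v → ∃ λ vs → Walk G s v vs

Dominates : ∀ {n} → Graph n → Fin n → Fin n → Fin n → Set
Dominates G s u v = ∀ vs → Walk G s v vs → u ∈ vs

IsIdom : ∀ {n} → Graph n → Fin n → Fin n → Fin n → Set
IsIdom G s u v =
  u ≢ v × Dominates G s u v ×
  (∀ w → w ≢ v → Dominates G s w v → Dominates G s w u)

DomChild : ∀ {n} → Graph n → Fin n → Fin n → Fin n → Set
DomChild G s u v = v ≢ s × IsIdom G s u v

NoOutdegreeOne : ∀ {n} → Graph n → Fin n → Set
NoOutdegreeOne G s =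
  ∀ u → ¬ (∃ λ v → DomChild G s u v × (∀ w → DomChild G s u w → w ≡ v))

-- Ancestry in the rooted tree given by the parent function p (root s;
-- p s is irrelevant).  Anc p s u v : u is a proper ancestor of v.
data Anc {n} (p : Fin n → Fin n) (s : Fin n) : Fin n → Fin n → Set where
  parent : ∀ {v} → v ≢ s → Anc p s (p v) v
  up     : ∀ {u v} → v ≢ s → Anc p s u (p v) → Anc p s u v

IsSpanningTree : ∀ {n} → Graph n → Fin n → (Fin n → Fin n) → Set
IsSpanningTree G s p =
  (∀ v → v ≢ s → Edge G (p v) v) × (∀ v → v ≡ s ⊎ Anc p s s v)

IsLinearOrder : ∀ {n} → List (Fin n) → Set
IsLinearOrder σ = Unique σ × (∀ v → v ∈ σ)

Precedes : ∀ {n} → List (Fin n) → Fin n → Fin n → Set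
Precedes σ u v = ∃ λ xs → ∃ λ ys → σ ≡ xs ++ ys × u ∈ xs × v ∈ ys

IsTreeLinearization : ∀ {n} → Fin n → (Fin n → Fin n) → List (Fin n) → Set
IsTreeLinearization s p σ =
  IsLinearOrder σ × (∀ u v → Anc p s u v → ¬ Precedes σ v u)

IsLinearization : ∀ {n} → Graph n → Fin n → List (Fin n) → Set
IsLinearization G s σ =
  ∃ λ p → IsSpanningTree G s p × IsTreeLinearization s p σ

LinAtLeast : ∀ {n} → Graph n → Fin n → ℕ → Set
LinAtLeast G s K =
  ∃ λ (L : List (List _)) → Unique L × K ≤ length L × All (IsLinearization G s) L

{-# OPTIONS --safe #-}
module Submission where

-- Explore G from s by a graph search: a prefix ρ of visited vertices is extended by a
-- frontier vertex, an unvisited vertex with an in-neighbour in ρ.  Every complete search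
-- order is a linearization (take as parent the first in-neighbour), and different choices
-- give different orders, so a frontier with two vertices doubles the count.  If the frontier
-- of ρ is a single vertex v, then v dominates every unvisited vertex; if the frontier after
-- visiting v were again a single vertex w, then w would be the only child of v in the
-- dominator tree.  So at least every second step branches, Lin(G) ≥ 2^⌊(n-1)/2⌋, and hence
-- 2^n ≤ Lin(G)^4 once n ≥ 4.

open import Defs
open import Data.Nat using (ℕ; _^_; _*_; _≤_; _<_)
open import Data.Fin using (Fin)
open import Data.Product using (∃; _×_; _,_)

open import Data.Nat using (zero; suc; pred; _+_; z≤n; s≤s; ⌊_/2⌋)
open import Data.Nat.Properties
  using (≤-refl; ≤-trans; <-trans; <-irrefl; <-≤-trans; ≤-pred; +-mono-≤; +-identityʳ;
         suc-injective; ^-monoʳ-≤; ^-*-assoc; *-identityˡ; ⌊n/2⌋-mono; n≤1+n; 1+n≢0; module ≤-Reasoning)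
open import Data.Fin using (_≟_)
open import Data.Bool using (true; false; T)
open import Data.Bool.Properties using (T?)
open import Data.Unit using (tt)
open import Data.Empty using (⊥; ⊥-elim)
open import Data.Sum using (_⊎_; inj₁; inj₂)
open import Data.Product using (proj₁; proj₂)
open import Data.List using (List; []; _∷_; _++_; [_]; length; map; filter; allFin)
open import Data.List.Properties
  using (++-assoc; ++-identityʳ; length-++; length-map; length-tabulate; ∷-injectiveˡ; ∷-injectiveʳ;
         filter-accept; filter-reject; filter-all; filter-none; filter-some)
open import Data.List.Membership.Propositional using (_∈_; _∉_; find; lose)
open import Data.List.Membership.Propositional.Properties
  using (∈-++⁺ˡ; ∈-++⁺ʳ; ∈-++⁻; ∈-filter⁺; ∈-filter⁻; ∈-allFin; ∈-map⁻)
open import Data.List.Relation.Unary.All as All using (All; []; _∷_)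
import Data.List.Relation.Unary.All.Properties as All
open import Data.List.Relation.Unary.Any using (Any; here; there; any?)
open import Data.List.Relation.Unary.Any.Properties using (¬Any[])
open import Data.List.Relation.Unary.AllPairs using ([]; _∷_)
open import Data.List.Relation.Unary.Unique.Propositional using (Unique)
import Data.List.Relation.Unary.Unique.Propositional.Properties as Unique
open import Data.List.Relation.Binary.Disjoint.Propositional using (Disjoint)
open import Relation.Binary.PropositionalEquality
  using (_≡_; _≢_; refl; sym; trans; cong; subst; module ≡-Reasoning)
open import Function using (id; _∘_; case_of_)
open import Relation.Nullary using (¬_; yes; no)
open import Relation.Nullary.Decidable using (_×-dec_)
open import Relation.Unary using (Decidable)

module _ {A : Set} where

  Unique[xs++ys]⇒Disjoint : ∀ xs {ys : List A} → Unique (xs ++ ys) → Disjoint xs ys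
  Unique[xs++ys]⇒Disjoint (x ∷ xs) (x∉ ∷ _) (here refl , x∈ys) = All.lookup x∉ (∈-++⁺ʳ xs x∈ys) refl
  Unique[xs++ys]⇒Disjoint (x ∷ xs) (_ ∷ u) (there y∈xs , y∈ys) = Unique[xs++ys]⇒Disjoint xs u (y∈xs , y∈ys)

  module _ {P Q : A → Set} (P? : Decidable P) (Q? : Decidable Q) where

    filter-cong : ∀ {xs} → All (λ x → (P x → Q x) × (Q x → P x)) xs → filter P? xs ≡ filter Q? xs
    filter-cong {[]} [] = refl
    filter-cong {x ∷ xs} ((P⇒Q , Q⇒P) ∷ P⇔Q) with P? x
    ... | yes Px = trans (cong (x ∷_) (filter-cong P⇔Q)) (sym (filter-accept Q? (P⇒Q Px)))
    ... | no ¬Px = trans (filter-cong P⇔Q) (sym (filter-reject Q? (¬Px ∘ Q⇒P)))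

    length-filter-remove : ∀ {v} xs → Unique xs → v ∈ xs → P v → ¬ Q v →
      (∀ {x} → x ≢ v → (P x → Q x) × (Q x → P x)) →
      length (filter P? xs) ≡ suc (length (filter Q? xs))
    length-filter-remove (x ∷ xs) (x∉xs ∷ _) (here refl) Pv ¬Qv P⇔Q = begin
      length (filter P? (x ∷ xs))  ≡⟨ cong length (filter-accept P? Pv) ⟩
      suc (length (filter P? xs))
        ≡⟨ cong (suc ∘ length) (filter-cong (All.map (λ v≢y → P⇔Q (v≢y ∘ sym)) x∉xs)) ⟩
      suc (length (filter Q? xs))  ≡⟨ cong (suc ∘ length) (sym (filter-reject Q? ¬Qv)) ⟩
      suc (length (filter Q? (x ∷ xs))) ∎
      where open ≡-Reasoning
    length-filter-remove (x ∷ xs) (x∉xs ∷ u) (there v∈xs) Pv ¬Qv P⇔Q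
      with P⇔Q (All.lookup x∉xs v∈xs) | P? x
    ... | (P⇒Q , _) | yes Px = trans (cong suc (length-filter-remove xs u v∈xs Pv ¬Qv P⇔Q))
                                (cong (suc ∘ length) (sym (filter-accept Q? (P⇒Q Px))))
    ... | (_ , Q⇒P) | no ¬Px = trans (length-filter-remove xs u v∈xs Pv ¬Qv P⇔Q)
                                (cong (suc ∘ length) (sym (filter-reject Q? (¬Px ∘ Q⇒P))))

data Multiplicity {n : ℕ} (P : Fin n → Set) : Set where
  none    : (∀ x → ¬ P x) → Multiplicity P
  one     : ∀ x → P x → (∀ y → P y → y ≡ x) → Multiplicity P
  several : ∀ {x y} → x ≢ y → P x → P y → Multiplicity P

multiplicity : ∀ {n} {P : Fin n → Set} → Decidable P → Multiplicity P
multiplicity {n} {P} P? =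
  classify (filter P? (allFin n))
    (λ x∈ → proj₂ (∈-filter⁻ P? {xs = allFin n} x∈)) (∈-filter⁺ P? (∈-allFin _))
    (Unique.filter⁺ P? (Unique.allFin⁺ n))
  where
  classify : ∀ xs → (∀ {x} → x ∈ xs → P x) → (∀ {x} → P x → x ∈ xs) → Unique xs → Multiplicity P
  classify []          _     listed _ = none (λ _ Px → ¬Any[] (listed Px))
  classify (x ∷ [])    sound listed _ = one x (sound (here refl)) λ where
    _ Py → case listed Py of λ where (here y≡x) → y≡x
  classify (x ∷ y ∷ _) sound _ ((x≢y ∷ _) ∷ _) = several x≢y (sound (here refl)) (sound (there (here refl)))

module _ {n : ℕ} {p : Fin n → Fin n} {s : Fin n}
         (μ : Fin n → ℕ) (μ-parent< : ∀ {v} → v ≢ s → μ (p v) < μ v) where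

  Anc⇒μ< : ∀ {u v} → Anc p s u v → μ u < μ v
  Anc⇒μ< (parent v≢s) = μ-parent< v≢s
  Anc⇒μ< (up v≢s a)   = <-trans (Anc⇒μ< a) (μ-parent< v≢s)

  root-or-descendant : ∀ v → v ≡ s ⊎ Anc p s s v
  root-or-descendant v = below (suc (μ v)) v ≤-refl
    where
    below : ∀ bound v → μ v < bound → v ≡ s ⊎ Anc p s s v
    below (suc bound) v μv<bound with v ≟ s
    ... | yes v≡s = inj₁ v≡s
    ... | no v≢s with below bound (p v) (<-≤-trans (μ-parent< v≢s) (≤-pred μv<bound))
    ...   | inj₁ pv≡s = inj₂ (subst (λ u → Anc p s u v) pv≡s (parent v≢s))
    ...   | inj₂ s<pv = inj₂ (up v≢s s<pv)

module _ {n : ℕ} where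

  position : List (Fin n) → Fin n → ℕ
  position []       x = 0
  position (y ∷ ys) x with x ≟ y
  ... | yes _ = 0
  ... | no  _ = suc (position ys x)

  position-∈ : ∀ {x} xs ys → x ∈ xs → position (xs ++ ys) x < length xs
  position-∈ {x} (y ∷ xs) ys x∈ with x ≟ y | x∈
  ... | yes _  | _          = s≤s z≤n
  ... | no x≢y | here x≡y   = ⊥-elim (x≢y x≡y)
  ... | no _   | there x∈xs = s≤s (position-∈ xs ys x∈xs)

  position-∉ : ∀ {x} xs ys → x ∉ xs → length xs ≤ position (xs ++ ys) x
  position-∉     []       ys _  = z≤n
  position-∉ {x} (y ∷ xs) ys x∉ with x ≟ y
  ... | yes refl = ⊥-elim (x∉ (here refl))
  ... | no _     = s≤s (position-∉ xs ys (x∉ ∘ there))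

  Precedes⇒position< : ∀ {σ : List (Fin n)} {u v} → Unique σ → Precedes σ u v →
                       position σ u < position σ v
  Precedes⇒position< uniq (xs , ys , refl , u∈xs , v∈ys) =
    <-≤-trans (position-∈ xs ys u∈xs)
              (position-∉ xs ys (λ v∈xs → Unique[xs++ys]⇒Disjoint xs uniq (v∈xs , v∈ys)))

  Precedes-++⁺ˡ : ∀ {σ : List (Fin n)} {u v} τ → Precedes σ u v → Precedes (σ ++ τ) u v
  Precedes-++⁺ˡ τ (xs , ys , refl , u∈xs , v∈ys) = xs , ys ++ τ , ++-assoc xs ys τ , u∈xs , ∈-++⁺ˡ v∈ys

module _ {A : Set} (P : List A → Set) where

  record Completions (ρ : List A) (k : ℕ) : Set where
    field
      suffixes : List (List A)
      complete : All (λ τ → P (ρ ++ τ)) suffixes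
      distinct : Unique suffixes
      many     : 2 ^ k ≤ length suffixes

module _ {A : Set} {P : List A → Set} where

  open Completions

  prepend : ∀ {ρ} v {k} → Completions P (ρ ++ [ v ]) k → Completions P ρ k
  prepend {ρ} v {k} c = record
    { suffixes = map (v ∷_) (suffixes c)
    ; complete = All.map⁺ (All.map (λ {τ} → subst P (++-assoc ρ [ v ] τ)) (complete c))
    ; distinct = Unique.map⁺ ∷-injectiveʳ (distinct c)
    ; many     = subst (2 ^ k ≤_) (sym (length-map (v ∷_) (suffixes c))) (many c)
    }

  merge : ∀ {ρ v₁ v₂ k} → v₁ ≢ v₂ →
          Completions P (ρ ++ [ v₁ ]) k → Completions P (ρ ++ [ v₂ ]) k → Completions P ρ (suc k)
  merge {ρ} {v₁} {v₂} {k} v₁≢v₂ c₁ c₂ = record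
    { suffixes = suffixes d₁ ++ suffixes d₂
    ; complete = All.++⁺ (complete d₁) (complete d₂)
    ; distinct = Unique.++⁺ (distinct d₁) (distinct d₂) heads-differ
    ; many     = begin
        2 ^ k + (2 ^ k + 0)                          ≡⟨ cong (2 ^ k +_) (+-identityʳ (2 ^ k)) ⟩
        2 ^ k + 2 ^ k                                ≤⟨ +-mono-≤ (many d₁) (many d₂) ⟩
        length (suffixes d₁) + length (suffixes d₂)  ≡⟨ length-++ (suffixes d₁) ⟨
        length (suffixes d₁ ++ suffixes d₂)          ∎
    }
    where
    open ≤-Reasoning
    d₁ d₂ : Completions P ρ k
    d₁ = prepend v₁ c₁
    d₂ = prepend v₂ c₂
    heads-differ : Disjoint (suffixes d₁) (suffixes d₂)
    heads-differ (τ∈d₁ , τ∈d₂) with ∈-map⁻ (v₁ ∷_) τ∈d₁ | ∈-map⁻ (v₂ ∷_) τ∈d₂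
    ... | _ , _ , refl | _ , _ , v₁∷τ≡v₂∷τ′ = v₁≢v₂ (∷-injectiveˡ v₁∷τ≡v₂∷τ′)

  weaken : ∀ {ρ j k} → j ≤ k → Completions P ρ k → Completions P ρ j
  weaken j≤k c = record
    { suffixes = suffixes c
    ; complete = complete c
    ; distinct = distinct c
    ; many     = ≤-trans (^-monoʳ-≤ 2 j≤k) (many c)
    }

module _ {n : ℕ} (G : Graph n) (s : Fin n) where

  open import Data.List.Membership.DecPropositional (_≟_ {n}) using (_∈?_; _∉?_)

  SearchOrder : List (Fin n) → Set
  SearchOrder σ = ∀ {v} → v ∈ σ → v ≢ s → ∃ λ u → Edge G u v × Precedes σ u v

  CompleteSearch : List (Fin n) → Set
  CompleteSearch σ = SearchOrder σ × IsLinearOrder σ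

  firstInNeighbour : List (Fin n) → Fin n → Fin n
  firstInNeighbour []       v = s
  firstInNeighbour (u ∷ us) v with G u v
  ... | true  = u
  ... | false = firstInNeighbour us v

  firstInNeighbour-∈ : ∀ {v} xs ys → Any (λ u → Edge G u v) xs →
    firstInNeighbour (xs ++ ys) v ∈ xs × Edge G (firstInNeighbour (xs ++ ys) v) v
  firstInNeighbour-∈ {v} (u ∷ xs) ys in-xs with G u v in uv
  ... | true = here refl , subst T (sym uv) tt
  firstInNeighbour-∈ (u ∷ xs) ys (here e)      | false = ⊥-elim (subst T uv e)
  firstInNeighbour-∈ (u ∷ xs) ys (there in-xs) | false =
    let p∈xs , e = firstInNeighbour-∈ xs ys in-xs in there p∈xs , e

  firstInNeighbour-precedes : ∀ {σ v} → SearchOrder σ → v ∈ σ → v ≢ s →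
    Edge G (firstInNeighbour σ v) v × Precedes σ (firstInNeighbour σ v) v
  firstInNeighbour-precedes ordered v∈σ v≢s with ordered v∈σ v≢s
  ... | u , e , xs , ys , refl , u∈xs , v∈ys =
    let p∈xs , pe = firstInNeighbour-∈ xs ys (lose u∈xs e) in pe , xs , ys , refl , p∈xs , v∈ys

  CompleteSearch⇒IsLinearization : ∀ {σ} → CompleteSearch σ → IsLinearization G s σ
  CompleteSearch⇒IsLinearization {σ} (ordered , linear@(uniq , covers)) =
    p , ((λ _ v≢s → proj₁ (parent-precedes v≢s)) , root-or-descendant μ μ-parent<) , linear , no-inversion
    where
    p : Fin n → Fin n
    p = firstInNeighbour σ
    μ : Fin n → ℕ
    μ = position σ
    parent-precedes : ∀ {v} → v ≢ s → Edge G (p v) v × Precedes σ (p v) v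
    parent-precedes v≢s = firstInNeighbour-precedes ordered (covers _) v≢s
    μ-parent< : ∀ {v} → v ≢ s → μ (p v) < μ v
    μ-parent< v≢s = Precedes⇒position< uniq (proj₂ (parent-precedes v≢s))
    no-inversion : ∀ u v → Anc p s u v → ¬ Precedes σ v u
    no-inversion u v u<v v≺u = <-irrefl refl (<-trans (Anc⇒μ< μ μ-parent< u<v) (Precedes⇒position< uniq v≺u))

  Frontier : List (Fin n) → Fin n → Set
  Frontier ρ x = x ∉ ρ × Any (λ u → Edge G u x) ρ

  frontier? : ∀ ρ → Decidable (Frontier ρ)
  frontier? ρ x = (x ∉? ρ) ×-dec any? (λ u → T? (G u x)) ρ

  SoleFrontier : List (Fin n) → Fin n → Set
  SoleFrontier ρ v = ∀ y → Frontier ρ y → y ≡ v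

  record SearchPrefix (ρ : List (Fin n)) : Set where
    field
      ordered    : SearchOrder ρ
      unique     : Unique ρ
      source     : s ∈ ρ
      walkWithin : ∀ {x} → x ∈ ρ → ∃ λ vs → Walk G s x vs × All (_∈ ρ) vs

  open SearchPrefix

  initial : SearchPrefix [ s ]
  initial = record
    { ordered    = λ { (here refl) s≢s → ⊥-elim (s≢s refl) }
    ; unique     = [] ∷ []
    ; source     = here refl
    ; walkWithin = λ { (here refl) → [ s ] , start , here refl ∷ [] }
    }

  extend : ∀ {ρ v} → SearchPrefix ρ → Frontier ρ v → SearchPrefix (ρ ++ [ v ])
  extend {ρ} {v} P (v∉ρ , in-ρ) = record
    { ordered    = ordered′
    ; unique     = Unique.++⁺ (unique P) ([] ∷ []) λ { (v∈ρ , here refl) → v∉ρ v∈ρ }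
    ; source     = ∈-++⁺ˡ (source P)
    ; walkWithin = walkWithin′
    }
    where
    ordered′ : SearchOrder (ρ ++ [ v ])
    ordered′ x∈ x≢s with ∈-++⁻ ρ x∈
    ... | inj₁ x∈ρ = let u , e , u≺x = ordered P x∈ρ x≢s in u , e , Precedes-++⁺ˡ [ v ] u≺x
    ... | inj₂ (here refl) = let u , u∈ρ , e = find in-ρ in u , e , ρ , [ v ] , refl , u∈ρ , here refl
    walkWithin′ : ∀ {x} → x ∈ ρ ++ [ v ] → ∃ λ vs → Walk G s x vs × All (_∈ ρ ++ [ v ]) vs
    walkWithin′ x∈ with ∈-++⁻ ρ x∈
    ... | inj₁ x∈ρ = let vs , W , inside = walkWithin P x∈ρ in vs , W , All.map ∈-++⁺ˡ inside
    ... | inj₂ (here refl) =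
      let u , u∈ρ , e = find in-ρ
          vs , W , inside = walkWithin P u∈ρ
      in v ∷ vs , step W e , ∈-++⁺ʳ ρ (here refl) ∷ All.map ∈-++⁺ˡ inside

  walk-crosses-frontier : ∀ {ρ w vs} → s ∈ ρ → w ∉ ρ → Walk G s w vs → ∃ λ y → y ∈ vs × Frontier ρ y
  walk-crosses-frontier     s∈ρ s∉ρ start = ⊥-elim (s∉ρ s∈ρ)
  walk-crosses-frontier {ρ} s∈ρ v∉ρ (step {u} W e) with u ∈? ρ
  ... | yes u∈ρ = _ , here refl , v∉ρ , lose u∈ρ e
  ... | no u∉ρ  =
    let y , y∈vs , y-frontier = walk-crosses-frontier s∈ρ u∉ρ W in y , there y∈vs , y-frontier

  sole-frontier-dominates : ∀ {ρ v x} → s ∈ ρ → SoleFrontier ρ v → x ∉ ρ → Dominates G s v x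
  sole-frontier-dominates s∈ρ sole x∉ρ vs W =
    let y , y∈vs , y-frontier = walk-crosses-frontier s∈ρ x∉ρ W in subst (_∈ vs) (sole y y-frontier) y∈vs

  dominator-visited : ∀ {ρ u x} → SearchPrefix ρ → x ∈ ρ → Dominates G s u x → u ∈ ρ
  dominator-visited P x∈ρ u-dom-x = let vs , W , inside = walkWithin P x∈ρ in All.lookup inside (u-dom-x vs W)

  consecutive-sole-frontiers : ∀ {ρ v w} → SearchPrefix ρ →
    Frontier ρ v → SoleFrontier ρ v → Frontier (ρ ++ [ v ]) w → SoleFrontier (ρ ++ [ v ]) w →
    DomChild G s v w × (∀ x → DomChild G s v x → x ≡ w)
  consecutive-sole-frontiers {ρ} {v} {w} P v-frontier@(v∉ρ , _) sole (w∉ρ′ , in-ρ′) sole′ =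
    child , only-child
    where
    ρ′ : List (Fin n)
    ρ′ = ρ ++ [ v ]
    P′ : SearchPrefix ρ′
    P′ = extend P v-frontier
    v∈ρ′ : v ∈ ρ′
    v∈ρ′ = ∈-++⁺ʳ ρ (here refl)
    w∉ρ : w ∉ ρ
    w∉ρ = w∉ρ′ ∘ ∈-++⁺ˡ
    -- An in-neighbour of w in ρ would make w a second frontier vertex of ρ.
    edge : Edge G v w
    edge with find in-ρ′
    ... | u , u∈ρ′ , e with ∈-++⁻ ρ u∈ρ′
    ...   | inj₂ (here refl) = e
    ...   | inj₁ u∈ρ = ⊥-elim (w∉ρ′ (subst (_∈ ρ′) (sym (sole w (w∉ρ , lose u∈ρ e))) v∈ρ′))
    child : DomChild G s v w
    child = (λ w≡s → w∉ρ′ (subst (_∈ ρ′) (sym w≡s) (source P′)))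
          , (λ v≡w → w∉ρ′ (subst (_∈ ρ′) v≡w v∈ρ′))
          , sole-frontier-dominates (source P) sole w∉ρ
          , λ y y≢w y-dom-w vs W → case y-dom-w (w ∷ vs) (step W edge) of λ where
              (here y≡w)  → ⊥-elim (y≢w y≡w)
              (there y∈vs) → y∈vs
    only-child : ∀ x → DomChild G s v x → x ≡ w
    only-child x (_ , v≢x , v-dom-x , idom) with x ∈? ρ | x ≟ w
    ... | yes x∈ρ | _       = ⊥-elim (v∉ρ (dominator-visited P x∈ρ v-dom-x))
    ... | no _    | yes x≡w = x≡w
    ... | no x∉ρ  | no x≢w  =
      ⊥-elim (w∉ρ′ (dominator-visited P′ v∈ρ′
        (idom w (x≢w ∘ sym) (sole-frontier-dominates (source P′) sole′ x∉ρ′))))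
      where
      x∉ρ′ : x ∉ ρ′
      x∉ρ′ x∈ρ′ with ∈-++⁻ ρ x∈ρ′
      ... | inj₁ x∈ρ        = x∉ρ x∈ρ
      ... | inj₂ (here x≡v) = v≢x (sym x≡v)

  unvisited : List (Fin n) → List (Fin n)
  unvisited ρ = filter (_∉? ρ) (allFin n)

  length-unvisited-[] : length (unvisited []) ≡ n
  length-unvisited-[] =
    trans (cong length (filter-all (_∉? []) (All.universal (λ _ ()) (allFin n)))) (length-tabulate id)

  length-unvisited-∷ʳ : ∀ {ρ v} → v ∉ ρ → length (unvisited ρ) ≡ suc (length (unvisited (ρ ++ [ v ])))
  length-unvisited-∷ʳ {ρ} {v} v∉ρ =
    length-filter-remove (_∉? ρ) (_∉? (ρ ++ [ v ])) (allFin n) (Unique.allFin⁺ n) (∈-allFin v) v∉ρ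
      (λ v∉ρ′ → v∉ρ′ (∈-++⁺ʳ ρ (here refl)))
      (λ x≢v → (λ x∉ρ x∈ρ′ → old-or-new x≢v x∉ρ (∈-++⁻ ρ x∈ρ′))
             , (λ x∉ρ′ x∈ρ → x∉ρ′ (∈-++⁺ˡ x∈ρ)))
    where
    old-or-new : ∀ {x} → x ≢ v → x ∉ ρ → x ∈ ρ ⊎ x ∈ [ v ] → ⊥
    old-or-new _   x∉ρ (inj₁ x∈ρ)        = x∉ρ x∈ρ
    old-or-new x≢v _   (inj₂ (here x≡v)) = x≢v x≡v

  no-unvisited⇒covers : ∀ {ρ} → length (unvisited ρ) ≡ 0 → ∀ v → v ∈ ρ
  no-unvisited⇒covers {ρ} unvisited≡0 v with v ∈? ρ
  ... | yes v∈ρ = v∈ρ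
  ... | no v∉ρ  = ⊥-elim (<-irrefl (sym unvisited≡0) (filter-some (_∉? ρ) (lose (∈-allFin v) v∉ρ)))

  covers⇒no-unvisited : ∀ {ρ} → (∀ v → v ∈ ρ) → length (unvisited ρ) ≡ 0
  covers⇒no-unvisited {ρ} covers =
    cong length (filter-none (_∉? ρ) (All.universal (λ v v∉ρ → v∉ρ (covers v)) (allFin n)))

  visit : ∀ {ρ v m} → length (unvisited ρ) ≡ suc m → Frontier ρ v → length (unvisited (ρ ++ [ v ])) ≡ m
  visit unvisited≡1+m (v∉ρ , _) = suc-injective (trans (sym (length-unvisited-∷ʳ v∉ρ)) unvisited≡1+m)

  finished : ∀ {ρ} → SearchPrefix ρ → (∀ v → v ∈ ρ) → Completions CompleteSearch ρ 0
  finished {ρ} P covers = record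
    { suffixes = [ [] ]
    ; complete = subst CompleteSearch (sym (++-identityʳ ρ)) (ordered P , unique P , covers) ∷ []
    ; distinct = [] ∷ []
    ; many     = ≤-refl
    }

  module _ (reachable : AllReachable G s) (no-outdegree-one : NoOutdegreeOne G s) where

    no-frontier⇒covers : ∀ {ρ} → SearchPrefix ρ → (∀ x → ¬ Frontier ρ x) → ∀ x → x ∈ ρ
    no-frontier⇒covers {ρ} P no-frontier x with x ∈? ρ
    ... | yes x∈ρ = x∈ρ
    ... | no x∉ρ  =
      let vs , W = reachable x
          y , _ , y-frontier = walk-crosses-frontier (source P) x∉ρ W
      in ⊥-elim (no-frontier y y-frontier)

    frontier-nonempty : ∀ {ρ m} → SearchPrefix ρ → length (unvisited ρ) ≡ suc m → ¬ (∀ x → ¬ Frontier ρ x)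
    frontier-nonempty P unvisited≡1+m no-frontier =
      1+n≢0 (trans (sym unvisited≡1+m) (covers⇒no-unvisited (no-frontier⇒covers P no-frontier)))

    completions : ∀ m {ρ} → SearchPrefix ρ → length (unvisited ρ) ≡ m →
                  Completions CompleteSearch ρ ⌊ m /2⌋
    completions zero    P unvisited≡0 = finished P (no-unvisited⇒covers unvisited≡0)
    completions (suc m) {ρ} P unvisited≡ with multiplicity (frontier? ρ)
    ... | none no-frontier = ⊥-elim (frontier-nonempty P unvisited≡ no-frontier)
    ... | several v₁≢v₂ f₁ f₂ =
      weaken (⌊n/2⌋-mono (n≤1+n (suc m)))
        (merge v₁≢v₂ (completions m (extend P f₁) (visit unvisited≡ f₁))
                     (completions m (extend P f₂) (visit unvisited≡ f₂)))
    ... | one v f sole with m | multiplicity (frontier? (ρ ++ [ v ]))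
    ...   | zero  | _ = prepend v (completions zero (extend P f) (visit unvisited≡ f))
    ...   | suc k | none no-frontier = ⊥-elim (frontier-nonempty (extend P f) (visit unvisited≡ f) no-frontier)
    ...   | suc k | one w f′ sole′ =
      ⊥-elim (no-outdegree-one v (w , consecutive-sole-frontiers P f sole f′ sole′))
    ...   | suc k | several w₁≢w₂ f₁ f₂ =
      prepend v (merge w₁≢w₂ (completions k (extend P′ f₁) (visit unvisited′≡ f₁))
                             (completions k (extend P′ f₂) (visit unvisited′≡ f₂)))
      where
      P′ : SearchPrefix (ρ ++ [ v ])
      P′ = extend P f
      unvisited′≡ : length (unvisited (ρ ++ [ v ])) ≡ suc k
      unvisited′≡ = visit unvisited≡ f

    Lin≥2^⌊n-1/2⌋ : LinAtLeast G s (2 ^ ⌊ pred n /2⌋)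
    Lin≥2^⌊n-1/2⌋ = suffixes c , distinct c , many c , All.map CompleteSearch⇒IsLinearization (complete c)
      where
      open Completions
      unvisited-initial : length (unvisited [ s ]) ≡ pred n
      unvisited-initial = cong pred (trans (sym (length-unvisited-∷ʳ (λ ()))) length-unvisited-[])
      c : Completions CompleteSearch [] ⌊ pred n /2⌋
      c = prepend s (completions (pred n) initial unvisited-initial)

k≤⌊1+k/2⌋*4 : ∀ k → k ≤ ⌊ suc k /2⌋ * 4
k≤⌊1+k/2⌋*4 zero          = z≤n
k≤⌊1+k/2⌋*4 (suc zero)    = s≤s z≤n
k≤⌊1+k/2⌋*4 (suc (suc k)) = +-mono-≤ (s≤s (s≤s z≤n)) (k≤⌊1+k/2⌋*4 k)

n≤⌊n-1/2⌋*4 : ∀ {n} → 4 ≤ n → n ≤ ⌊ pred n /2⌋ * 4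
n≤⌊n-1/2⌋*4 (s≤s (s≤s (s≤s (s≤s {n = k} _)))) = s≤s (s≤s (s≤s (s≤s (k≤⌊1+k/2⌋*4 k))))

mainTheorem14 : ∃ λ (a : ℕ) → ∃ λ (b : ℕ) → ∃ λ (N : ℕ) → 0 < a × 0 < b ×
    (∀ (n : ℕ) → N ≤ n → (G : Graph n) → (s : Fin n) →
      AllReachable G s → NoOutdegreeOne G s →
      ∃ λ (K : ℕ) → 2 ^ (a * n) ≤ K ^ b × LinAtLeast G s K)
mainTheorem14 = 1 , 4 , 4 , s≤s z≤n , s≤s z≤n , λ n 4≤n G s reachable no-outdegree-one →
  2 ^ ⌊ pred n /2⌋ , exponent-bound 4≤n , Lin≥2^⌊n-1/2⌋ G s reachable no-outdegree-one
  where
  exponent-bound : ∀ {n} → 4 ≤ n → 2 ^ (1 * n) ≤ (2 ^ ⌊ pred n /2⌋) ^ 4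
  exponent-bound {n} 4≤n = begin
    2 ^ (1 * n)             ≡⟨ cong (2 ^_) (*-identityˡ n) ⟩
    2 ^ n                   ≤⟨ ^-monoʳ-≤ 2 (n≤⌊n-1/2⌋*4 4≤n) ⟩
    2 ^ (⌊ pred n /2⌋ * 4)  ≡⟨ ^-*-assoc 2 ⌊ pred n /2⌋ 4 ⟨
    (2 ^ ⌊ pred n /2⌋) ^ 4  ∎
    where open ≤-Reasoning
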